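{- Let $\Gamma$ be a (finite) constraint language such that for every $n\ge1$ and every permutation $\sigma:\underline n\to\underline n$, the graph $\sigma^\bullet=\{(x,\sigma(x)):x\in\underline n\}$ is $\mathrm{Mo}$-fgpp-definable over $\Gamma$. Then $\Gamma$ does not have the connector property.
   Context: Write $\underline d=\{0,\dots,d-1\}$ with natural order. Relations have their own finite domain; a constraint language is a finite set of relations. A relation $R\subseteq\underline n^r$ is $\mathrm{Mo}$-fgpp-definable over $\Gamma$ if it is the set of $x\in\underline n^r$ satisfying a finite conjunction of atoms $S(h_1(x_{j_1}),\dots,h_s(x_{j_s}))$ with $S\in\Gamma$ of domain $\underline e$ and monotone maps $h_i:\underline n\to\underline e$ (no quantifiers, no equality atoms). A partial multivalued operation of arity $k$ on $D$ is $f:D^k\to2^D$; for a set $M$ of maps $D\to E$, $f_M(y_1,\dots,y_k)=\bigcup_{m\in M}\{m(z):z\in f(x_1,\dots,x_k),m(x_i)=y_i\ \forall i\}$; $g$ on $E$ preserves $R\subseteq E^r$ if for all $t_1,\dots,t_k\in R$, every $u$ with $u[j]\in g(t_1[j],\dots,t_k[j])$ for all $j$ lies in $R$. The connector pattern $\mathsf{con}$ is the 5-ary operation on $\underline3$ with $\mathsf{con}(0,0,1,2,2)=\{0\}$, $\mathsf{con}(0,2,1,0,2)=\{1\}$, $\emptyset$ elsewhere; $\Gamma$ has the connector property if for each $R\in\Gamma$ with domain $\underline d$, $\mathsf{con}_M$ preserves $R$ for $M$ the set of monotone or anti-monotone maps $\underline3\to\underline d$. -}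

module Defs where

open import Data.Nat using (ℕ; suc)
open import Data.Fin using (Fin; zero; suc; _≤_)
open import Data.Vec using (Vec; []; _∷_; map)
open import Data.List using (List)
open import Data.List.Relation.Unary.All using (All)
open import Data.Product using (Σ; ∃; _×_; _,_)
open import Data.Sum using (_⊎_)
open import Data.Empty using (⊥)
open import Relation.Binary.PropositionalEquality using (_≡_)
open import Function.Bundles using (_⇔_)
open import Data.Fin.Permutation using (Permutation′; _⟨$⟩ʳ_)

record Relation : Set₁ where
  field
    dom : ℕ
    ar  : ℕ
    mem : (Fin ar → Fin dom) → Set
open Relation public

record Language : Set₁ where
  field
    size : ℕ
    rel  : Fin size → Relation
open Language public

Monotone : ∀ {n e} → (Fin n → Fin e) → Set
Monotone h = ∀ i j → i ≤ j → h i ≤ h j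

AntiMonotone : ∀ {n e} → (Fin n → Fin e) → Set
AntiMonotone h = ∀ i j → i ≤ j → h j ≤ h i

-- An atom  S(h_1(x_{j_1}),…,h_s(x_{j_s}))  over Γ, in variables x : Fin r → Fin n.
record Atom (Γ : Language) (n r : ℕ) : Set where
  field
    sym  : Fin (size Γ)
    var  : Fin (ar (rel Γ sym)) → Fin r
    map' : Fin (ar (rel Γ sym)) → Fin n → Fin (dom (rel Γ sym))
    mono : ∀ i → Monotone (map' i)
open Atom public

satAtom : ∀ {Γ n r} → (Fin r → Fin n) → Atom Γ n r → Set
satAtom {Γ} x a = mem (rel Γ (sym a)) (λ i → map' a i (x (var a i)))

MoFgppDefinable : Language → Relation → Set
MoFgppDefinable Γ R =
  Σ (List (Atom Γ (dom R) (ar R))) λ φ →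
    ∀ (x : Fin (ar R) → Fin (dom R)) → (mem R x ⇔ All (satAtom x) φ)

graph : ∀ {n} → Permutation′ n → Relation
graph {n} σ = record
  { dom = n ; ar = 2 ; mem = λ t → σ ⟨$⟩ʳ t zero ≡ t (suc zero) }

-- Partial multivalued k-ary operation on Fin d:  f x is the set {z | f x z}.
MultiOp : ℕ → ℕ → Set₁
MultiOp d k = Vec (Fin d) k → Fin d → Set

f0 f1 f2 : Fin 3
f0 = zero
f1 = suc zero
f2 = suc (suc zero)

con : MultiOp 3 5
con x z = (x ≡ f0 ∷ f0 ∷ f1 ∷ f2 ∷ f2 ∷ [] × z ≡ f0)
        ⊎ (x ≡ f0 ∷ f2 ∷ f1 ∷ f0 ∷ f2 ∷ [] × z ≡ f1)

conM : (d : ℕ) → MultiOp d 5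
conM d ys w =
  Σ (Fin 3 → Fin d) λ m → (Monotone m ⊎ AntiMonotone m) ×
    Σ (Vec (Fin 3) 5) λ x → Σ (Fin 3) λ z →
      con x z × m z ≡ w × map m x ≡ ys

column : ∀ {k r d} → Vec (Fin r → Fin d) k → Fin r → Vec (Fin d) k
column ts j = map (λ t → t j) ts

Preserves : ∀ {k} (R : Relation) → MultiOp (dom R) k → Set
Preserves {k} R g =
  ∀ (ts : Vec (Fin (ar R) → Fin (dom R)) k) → Data.Vec.Relation.Unary.All.All (mem R) ts →
  ∀ (u : Fin (ar R) → Fin (dom R)) → (∀ j → g (column ts j) (u j)) → mem R u
  where import Data.Vec.Relation.Unary.All

ConnectorProperty : Language → Set
ConnectorProperty Γ = ∀ s → Preserves (rel Γ s) (conM (dom (rel Γ s)))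

{-# OPTIONS --safe #-}

-- Let σ ⟨u, v⟩ = ⟨v, u⟩ transpose the grid Fin (N * N), ordered lexicographically, and fix an
-- atom of a definition of σ's graph. The sum of the atom's monotone maps is bounded by a
-- constant K depending only on Γ, and it grows across every row on which some map is not
-- constant; so among any K + 1 rows one is constant for the atom. For N = 2K + 4 this gives
-- constant rows w₁ < m and w₂ > m′ around two middle rows m < m′. Three applications of con,
-- to pairs (x, σ x) and to pairs already obtained, make the atom hold at (⟨m, m⟩, ⟨m′, m⟩):
-- the constant rows absorb the mismatch between con's patterns and the available pairs.
-- Hence the definition would give σ ⟨m, m⟩ = ⟨m′, m⟩, whereas σ ⟨m, m⟩ = ⟨m, m⟩.

module Submission where

open import Defs
open import Data.Nat as ℕ using (ℕ; zero; suc; _+_; _*_; _≤_; z≤n; s≤s)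
import Data.Nat.Properties as ℕ
open import Data.Fin as Fin using (Fin; zero; suc; toℕ; fromℕ; combine; remQuot; _↑ˡ_; _↑ʳ_)
import Data.Fin.Properties as Fin
open import Data.Fin.Permutation using (Permutation′; permutation; _⟨$⟩ʳ_)
open import Data.Vec using (Vec; []; _∷_; map; lookup)
open import Data.Vec.Properties using (map-∘)
open import Data.Vec.Relation.Unary.All as VecAll using ([]; _∷_)
import Data.Vec.Relation.Unary.All.Properties as VecAll
open import Data.Vec.Relation.Binary.Pointwise.Inductive using (Pointwise; []; _∷_)
open import Data.List using (List)
open import Data.List.Membership.Propositional using (_∈_)
open import Data.List.Relation.Unary.All as All using (All)
open import Data.Product using (∃; _×_; _,_; proj₁; proj₂; map₂; uncurry)
open import Data.Sum using (_⊎_; inj₁; inj₂)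
open import Function using (_∘_; flip; _⇔_; Equivalence)
open import Relation.Binary.Core using (Rel)
open import Relation.Binary.Definitions using (Reflexive; Transitive)
open import Relation.Binary.PropositionalEquality as ≡ using (_≡_; refl; trans; cong; subst; subst₂)
open import Relation.Nullary using (¬_; yes; no)
open import Algebra.Properties.Monoid.Sum ℕ.+-0-monoid using (sum; sum-syntax)

sum-mono-≤ : ∀ {k} {f g : Fin k → ℕ} → (∀ i → f i ≤ g i) → sum f ≤ sum g
sum-mono-≤ {zero}  f≤g = z≤n
sum-mono-≤ {suc k} f≤g = ℕ.+-mono-≤ (f≤g zero) (sum-mono-≤ (f≤g ∘ suc))

≤-sum : ∀ {k} (f : Fin k → ℕ) i → f i ≤ sum f
≤-sum f zero    = ℕ.m≤m+n _ _
≤-sum f (suc i) = ℕ.≤-trans (≤-sum (f ∘ suc) i) (ℕ.m≤n+m _ (f zero))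

+-mono-≤-reflects-≡ : ∀ {a b c d} → a ≤ c → b ≤ d → a + b ≡ c + d → a ≡ c × b ≡ d
+-mono-≤-reflects-≡ {a} {b} {c} {d} a≤c b≤d eq =
  a≡c , ℕ.+-cancelˡ-≡ a b d (trans eq (cong (_+ d) (≡.sym a≡c)))
  where
  a≡c : a ≡ c
  a≡c = ℕ.≤-antisym a≤c (ℕ.+-cancelʳ-≤ d c a (ℕ.≤-trans (ℕ.≤-reflexive (≡.sym eq)) (ℕ.+-monoʳ-≤ a b≤d)))

sum-≡⇒≗ : ∀ {k} {f g : Fin k → ℕ} → (∀ i → f i ≤ g i) → sum f ≡ sum g → ∀ i → f i ≡ g i
sum-≡⇒≗ {suc k} {f} {g} f≤g eq = pointwise
  where
  head-and-tail : f zero ≡ g zero × sum (f ∘ suc) ≡ sum (g ∘ suc)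
  head-and-tail = +-mono-≤-reflects-≡ (f≤g zero) (sum-mono-≤ (f≤g ∘ suc)) eq
  pointwise : ∀ i → f i ≡ g i
  pointwise zero    = proj₁ head-and-tail
  pointwise (suc i) = sum-≡⇒≗ (f≤g ∘ suc) (proj₂ head-and-tail) i

chain-stalls : ∀ {L} (S E : Fin (suc L) → ℕ) → (∀ i → S i ≤ E i) →
               (∀ {i j} → i Fin.< j → E i ≤ S j) → (∀ i → E i ≤ L + S zero) →
               ∃ λ i → S i ≡ E i
chain-stalls {zero}  S E S≤E E≤S E≤L+S₀ = zero , ℕ.≤-antisym (S≤E zero) (E≤L+S₀ zero)
chain-stalls {suc L} S E S≤E E≤S E≤L+S₀ with S zero ℕ.≟ E zero
... | yes S₀≡E₀ = zero , S₀≡E₀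
... | no  S₀≢E₀ =
  let i , Sᵢ≡Eᵢ = chain-stalls (S ∘ suc) (E ∘ suc) (S≤E ∘ suc) (λ i<j → E≤S (s≤s i<j)) E≤L+S₁
  in suc i , Sᵢ≡Eᵢ
  where
  S₀<S₁ : S zero ℕ.< S (suc zero)
  S₀<S₁ = ℕ.<-≤-trans (ℕ.≤∧≢⇒< (S≤E zero) S₀≢E₀) (E≤S (s≤s z≤n))
  E≤L+S₁ : ∀ i → E (suc i) ≤ L + S (suc zero)
  E≤L+S₁ i = ℕ.≤-trans (E≤L+S₀ (suc i))
               (ℕ.≤-trans (ℕ.≤-reflexive (≡.sym (ℕ.+-suc L (S zero)))) (ℕ.+-monoʳ-≤ L S₀<S₁))

↑ˡ-mono-< : ∀ {m} n {i j : Fin m} → i Fin.< j → i ↑ˡ n Fin.< j ↑ˡ n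
↑ˡ-mono-< n {zero}  {suc j} i<j       = s≤s z≤n
↑ˡ-mono-< n {suc i} {suc j} (s≤s i<j) = s≤s (↑ˡ-mono-< n i<j)

↑ʳ-mono-< : ∀ {m} n {i j : Fin m} → i Fin.< j → n ↑ʳ i Fin.< n ↑ʳ j
↑ʳ-mono-< zero    i<j = i<j
↑ʳ-mono-< (suc n) i<j = s≤s (↑ʳ-mono-< n i<j)

↑ˡ-<-↑ʳ : ∀ {m n} (i : Fin m) (j : Fin n) → i ↑ˡ n Fin.< m ↑ʳ j
↑ˡ-<-↑ʳ zero    j = s≤s z≤n
↑ˡ-<-↑ʳ (suc i) j = s≤s (↑ˡ-<-↑ʳ i j)

combine-monoʳ-≤ : ∀ {m n} (i : Fin m) {j l : Fin n} → j Fin.≤ l → combine i j Fin.≤ combine i l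
combine-monoʳ-≤ {n = n} i {j} {l} j≤l =
  subst₂ _≤_ (≡.sym (Fin.toℕ-combine i j)) (≡.sym (Fin.toℕ-combine i l)) (ℕ.+-monoʳ-≤ (n * toℕ i) j≤l)

monotone-squeeze : ∀ {n d} {h : Fin n → Fin d} → Monotone h → ∀ {x y z} →
                   x Fin.≤ y → y Fin.≤ z → h x ≡ h z → h y ≡ h x
monotone-squeeze {h = h} h-mono {x} {y} {z} x≤y y≤z hx≡hz =
  Fin.≤-antisym (subst (h y Fin.≤_) (≡.sym hx≡hz) (h-mono y z y≤z)) (h-mono x y x≤y)

Between : ∀ {n} → Fin n → Fin n → Fin n → Set
Between x₀ x₁ x₂ = (x₀ Fin.≤ x₁ × x₁ Fin.≤ x₂) ⊎ (x₁ Fin.≤ x₀ × x₂ Fin.≤ x₁)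

lookup-chain₃ : ∀ {a ℓ} {A : Set a} (_≲_ : Rel A ℓ) → Reflexive _≲_ → Transitive _≲_ →
                ∀ {x₀ x₁ x₂} → x₀ ≲ x₁ → x₁ ≲ x₂ →
                ∀ i j → i Fin.≤ j → lookup (x₀ ∷ x₁ ∷ x₂ ∷ []) i ≲ lookup (x₀ ∷ x₁ ∷ x₂ ∷ []) j
lookup-chain₃ _≲_ refl′ trans′ p q zero             zero             _ = refl′
lookup-chain₃ _≲_ refl′ trans′ p q zero             (suc zero)       _ = p
lookup-chain₃ _≲_ refl′ trans′ p q zero             (suc (suc zero)) _ = trans′ p q
lookup-chain₃ _≲_ refl′ trans′ p q (suc zero)       (suc zero)       _ = refl′
lookup-chain₃ _≲_ refl′ trans′ p q (suc zero)       (suc (suc zero)) _ = q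
lookup-chain₃ _≲_ refl′ trans′ p q (suc (suc zero)) (suc (suc zero)) _ = refl′
lookup-chain₃ _≲_ refl′ trans′ p q (suc zero)       zero             ()
lookup-chain₃ _≲_ refl′ trans′ p q (suc (suc zero)) zero             ()
lookup-chain₃ _≲_ refl′ trans′ p q (suc (suc zero)) (suc zero)       (s≤s ())

between⇒monotone⊎antiMonotone : ∀ {n d} {h : Fin n → Fin d} → Monotone h →
  ∀ {x₀ x₁ x₂} → Between x₀ x₁ x₂ →
  Monotone (h ∘ lookup (x₀ ∷ x₁ ∷ x₂ ∷ [])) ⊎ AntiMonotone (h ∘ lookup (x₀ ∷ x₁ ∷ x₂ ∷ []))
between⇒monotone⊎antiMonotone {h = h} h-mono (inj₁ (x₀≤x₁ , x₁≤x₂)) =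
  inj₁ (lookup-chain₃ (λ x y → h x Fin.≤ h y) Fin.≤-refl Fin.≤-trans
          (h-mono _ _ x₀≤x₁) (h-mono _ _ x₁≤x₂))
between⇒monotone⊎antiMonotone {h = h} h-mono (inj₂ (x₁≤x₀ , x₂≤x₁)) =
  inj₂ (lookup-chain₃ (λ x y → h y Fin.≤ h x) Fin.≤-refl (flip Fin.≤-trans)
          (h-mono _ _ x₁≤x₀) (h-mono _ _ x₂≤x₁))

conM-endpoint : ∀ {n d} {h : Fin n → Fin d} → Monotone h → ∀ {x₀ x₁ x₂} → Between x₀ x₁ x₂ →
                conM d (h x₀ ∷ h x₀ ∷ h x₁ ∷ h x₂ ∷ h x₂ ∷ []) (h x₀)
conM-endpoint {h = h} h-mono {x₀} {x₁} {x₂} b =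
  h ∘ lookup (x₀ ∷ x₁ ∷ x₂ ∷ []) , between⇒monotone⊎antiMonotone h-mono b ,
  _ , f0 , inj₁ (refl , refl) , refl , refl

conM-midpoint : ∀ {n d} {h : Fin n → Fin d} → Monotone h → ∀ {x₀ x₁ x₂} → Between x₀ x₁ x₂ →
                conM d (h x₀ ∷ h x₂ ∷ h x₁ ∷ h x₀ ∷ h x₂ ∷ []) (h x₁)
conM-midpoint {h = h} h-mono {x₀} {x₁} {x₂} b =
  h ∘ lookup (x₀ ∷ x₁ ∷ x₂ ∷ []) , between⇒monotone⊎antiMonotone h-mono b ,
  _ , f1 , inj₂ (refl , refl) , refl , refl

Agree : ∀ {k n d} → (Fin k → Fin n → Fin d) → Fin n → Fin n → Set
Agree h x y = ∀ i → h i x ≡ h i y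

RowConstant : ∀ {k N C d} → (Fin k → Fin (N * C) → Fin d) → Fin N → Set
RowConstant h w = ∀ u v → Agree h (combine w u) (combine w v)

module _ {k N c d} (h : Fin k → Fin (N * suc c) → Fin d) (h-mono : ∀ i → Monotone (h i)) where

  private
    potential : Fin (N * suc c) → ℕ
    potential x = ∑[ i < k ] toℕ (h i x)

    rowStart rowEnd : Fin N → Fin (N * suc c)
    rowStart w = combine w zero
    rowEnd   w = combine w (fromℕ c)

    rowStart≤rowEnd : ∀ w → rowStart w Fin.≤ rowEnd w
    rowStart≤rowEnd w = combine-monoʳ-≤ w z≤n

    rowConstant : ∀ w → potential (rowStart w) ≡ potential (rowEnd w) → RowConstant h w
    rowConstant w ends-≡ u v i = trans (squeeze u) (≡.sym (squeeze v))
      where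
      ends : h i (rowStart w) ≡ h i (rowEnd w)
      ends = Fin.toℕ-injective (sum-≡⇒≗ (λ j → h-mono j _ _ (rowStart≤rowEnd w)) ends-≡ i)
      squeeze : ∀ u → h i (combine w u) ≡ h i (rowStart w)
      squeeze u =
        monotone-squeeze (h-mono i) (combine-monoʳ-≤ w z≤n) (combine-monoʳ-≤ w (Fin.≤fromℕ u)) ends

  rowConstant-among : ∀ {L} (ρ : Fin (suc L) → Fin N) → (∀ {i j} → i Fin.< j → ρ i Fin.< ρ j) →
                      ∑[ i < k ] d ≤ L → ∃ λ i → RowConstant h (ρ i)
  rowConstant-among {L} ρ ρ-mono bound = map₂ (rowConstant (ρ _)) (chain-stalls S E S≤E E≤S E≤L+S₀)
    where
    potential-mono : ∀ {x y} → x Fin.≤ y → potential x ≤ potential y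
    potential-mono x≤y = sum-mono-≤ (λ i → h-mono i _ _ x≤y)
    S E : Fin (suc L) → ℕ
    S = potential ∘ rowStart ∘ ρ
    E = potential ∘ rowEnd ∘ ρ
    S≤E : ∀ i → S i ≤ E i
    S≤E i = potential-mono (rowStart≤rowEnd (ρ i))
    E≤S : ∀ {i j} → i Fin.< j → E i ≤ S j
    E≤S i<j = potential-mono (ℕ.<⇒≤ (Fin.combine-monoˡ-< _ _ (ρ-mono i<j)))
    E≤L+S₀ : ∀ i → E i ≤ L + S zero
    E≤L+S₀ i = ℕ.≤-trans (sum-mono-≤ (λ j → ℕ.<⇒≤ (Fin.toℕ<n (h j _))))
                 (ℕ.≤-trans bound (ℕ.m≤m+n L (S zero)))

pair : ∀ {A : Set} → A → A → Fin 2 → A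
pair p q = lookup (p ∷ q ∷ [])

Sat₂ : ∀ {Γ n} → Atom Γ n 2 → Fin n → Fin n → Set
Sat₂ at p q = satAtom (pair p q) at

ConnectorStep : ∀ {Γ n r} → Atom Γ n r → Vec (Fin n) 5 → Fin n → Set
ConnectorStep at ys y = ∀ i → conM _ (map (map' at i) ys) (map' at i y)

module _ {Γ n r} (at : Atom Γ n r)
         (closed : Preserves (rel Γ (sym at)) (conM (dom (rel Γ (sym at))))) where

  satAtom-conM-closed : (xs : Vec (Fin r → Fin n) 5) → VecAll.All (λ x → satAtom x at) xs →
                        (x : Fin r → Fin n) → (∀ l → ConnectorStep at (map (λ y → y l) xs) (x l)) →
                        satAtom x at
  satAtom-conM-closed xs sat x step =
    closed (map image xs) (VecAll.map⁺ sat) (image x)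
      (λ j → subst (λ ys → conM _ ys _) (≡.sym (column-image j)) (step (var at j) j))
    where
    image : (Fin r → Fin n) → Fin (ar (rel Γ (sym at))) → Fin (dom (rel Γ (sym at)))
    image y j = map' at j (y (var at j))
    column-image : ∀ j → column (map image xs) j ≡ map (map' at j) (map (λ y → y (var at j)) xs)
    column-image j =
      trans (≡.sym (map-∘ (λ t → t j) image xs)) (map-∘ (map' at j) (λ y → y (var at j)) xs)

module _ {Γ n} (at : Atom Γ n 2)
         (closed : Preserves (rel Γ (sym at)) (conM (dom (rel Γ (sym at))))) where

  sat₂-conM-closed : ∀ ps qs {p q} → Pointwise (Sat₂ at) ps qs →
                     ConnectorStep at ps p → ConnectorStep at qs q → Sat₂ at p q
  sat₂-conM-closed (p₁ ∷ p₂ ∷ p₃ ∷ p₄ ∷ p₅ ∷ []) (q₁ ∷ q₂ ∷ q₃ ∷ q₄ ∷ q₅ ∷ []) {p} {q}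
                   (s₁ ∷ s₂ ∷ s₃ ∷ s₄ ∷ s₅ ∷ []) p-step q-step =
    satAtom-conM-closed at closed
      (pair p₁ q₁ ∷ pair p₂ q₂ ∷ pair p₃ q₃ ∷ pair p₄ q₄ ∷ pair p₅ q₅ ∷ [])
      (s₁ ∷ s₂ ∷ s₃ ∷ s₄ ∷ s₅ ∷ []) (pair p q)
      λ { zero → p-step ; (suc zero) → q-step }

module _ {Γ n r} (at : Atom Γ n r) where

  endpoint-step : ∀ {x₀ x₁ x₂ y y′} → Between x₀ x₁ x₂ →
                  Agree (map' at) y x₀ → Agree (map' at) y′ x₂ →
                  ConnectorStep at (x₀ ∷ y ∷ x₁ ∷ x₂ ∷ y′ ∷ []) x₀
  endpoint-step b y≈x₀ y′≈x₂ i rewrite y≈x₀ i | y′≈x₂ i = conM-endpoint (mono at i) b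

  midpoint-step : ∀ {x₀ x₁ x₂ y y′} → Between x₀ x₁ x₂ →
                  Agree (map' at) y x₀ → Agree (map' at) y′ x₂ →
                  ConnectorStep at (x₀ ∷ x₂ ∷ x₁ ∷ y ∷ y′ ∷ []) x₁
  midpoint-step b y≈x₀ y′≈x₂ i rewrite y≈x₀ i | y′≈x₂ i = conM-midpoint (mono at i) b

module _ {Γ N} (at : Atom Γ (N * N) 2)
         (closed : Preserves (rel Γ (sym at)) (conM (dom (rel Γ (sym at)))))
         (mirror : ∀ (u v : Fin N) → Sat₂ at (combine u v) (combine v u)) where

  transpose-closure : ∀ {w₁ m m′ w₂ : Fin N} → w₁ Fin.< m → m Fin.≤ m′ → m′ Fin.< w₂ →
                      RowConstant (map' at) w₁ → RowConstant (map' at) w₂ →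
                      Sat₂ at (combine m m) (combine m′ m)
  transpose-closure {w₁} {m} {m′} {w₂} w₁<m m≤m′ m′<w₂ flat₁ flat₂ =
    sat₂-conM-closed at closed
      (mm ∷ mm ∷ mm′ ∷ a₂₁ ∷ a₂₂ ∷ []) (a₁₁ ∷ a₂₁ ∷ m′m ∷ a₁₂ ∷ a₂₂ ∷ [])
      (mm~a₁₁ ∷ mm~a₂₁ ∷ mirror m m′ ∷ mirror w₂ w₁ ∷ mirror w₂ w₂ ∷ [])
      (endpoint-step at (inj₁ (combine-monoʳ-≤ m m≤m′ , across m<w₂)) (λ _ → refl) (flat₂ w₂ w₁))
      (midpoint-step at (inj₁ (across w₁<m′ , across m′<w₂)) (flat₁ w₂ w₁) (flat₂ w₂ w₁))
    where
    w₁<m′ : w₁ Fin.< m′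
    w₁<m′ = ℕ.<-≤-trans w₁<m m≤m′
    m<w₂ : m Fin.< w₂
    m<w₂ = ℕ.≤-<-trans m≤m′ m′<w₂
    across : ∀ {r r′ c c′ : Fin N} → r Fin.< r′ → combine r c Fin.≤ combine r′ c′
    across r<r′ = ℕ.<⇒≤ (Fin.combine-monoˡ-< _ _ r<r′)
    mm mm′ m′m a₁₁ a₁₂ a₂₁ a₂₂ : Fin (N * N)
    mm  = combine m m
    mm′ = combine m m′
    m′m = combine m′ m
    a₁₁ = combine w₁ w₁
    a₁₂ = combine w₁ w₂
    a₂₁ = combine w₂ w₁
    a₂₂ = combine w₂ w₂
    mm~a₁₁ : Sat₂ at mm a₁₁
    mm~a₁₁ = sat₂-conM-closed at closed
      (a₁₁ ∷ a₂₁ ∷ mm ∷ a₁₂ ∷ a₂₂ ∷ []) (a₁₁ ∷ a₁₂ ∷ mm ∷ a₂₁ ∷ a₂₂ ∷ [])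
      (mirror w₁ w₁ ∷ mirror w₂ w₁ ∷ mirror m m ∷ mirror w₁ w₂ ∷ mirror w₂ w₂ ∷ [])
      (midpoint-step at (inj₁ (across w₁<m , across m<w₂)) (flat₁ w₂ w₁) (flat₂ w₂ w₁))
      (endpoint-step at (inj₁ (across w₁<m , across m<w₂)) (flat₁ w₂ w₁) (flat₂ w₂ w₁))
    mm~a₂₁ : Sat₂ at mm a₂₁
    mm~a₂₁ = sat₂-conM-closed at closed
      (a₁₂ ∷ a₂₂ ∷ mm ∷ a₁₁ ∷ a₂₁ ∷ []) (a₂₁ ∷ a₂₂ ∷ mm ∷ a₁₁ ∷ a₁₂ ∷ [])
      (mirror w₁ w₂ ∷ mirror w₂ w₂ ∷ mirror m m ∷ mirror w₁ w₁ ∷ mirror w₂ w₁ ∷ [])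
      (midpoint-step at (inj₁ (across w₁<m , across m<w₂)) (flat₁ w₁ w₂) (flat₂ w₁ w₂))
      (endpoint-step at (inj₂ (across m<w₂ , across w₁<m)) (flat₂ w₂ w₁) (flat₁ w₂ w₁))

transposeIndex : ∀ N → Fin (N * N) → Fin (N * N)
transposeIndex N x = uncurry (flip combine) (remQuot N x)

transposeIndex-combine : ∀ {N} (u v : Fin N) → transposeIndex N (combine u v) ≡ combine v u
transposeIndex-combine u v = cong (uncurry (flip combine)) (Fin.remQuot-combine u v)

gridTranspose : ∀ N → Permutation′ (N * N)
gridTranspose N = permutation (transposeIndex N) (transposeIndex N) involutive involutive
  where
  involutive : ∀ x → transposeIndex N (transposeIndex N x) ≡ x
  involutive x = trans (transposeIndex-combine {N} _ _) (Fin.combine-remQuot {N} N x)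

module Grid (K : ℕ) where

  N : ℕ
  N = suc K + suc (suc (suc K))

  below above : Fin (suc K) → Fin N
  below i = i ↑ˡ _
  above i = suc K ↑ʳ suc (suc i)

  mid mid′ : Fin N
  mid  = suc K ↑ʳ zero
  mid′ = suc K ↑ʳ suc zero

  mid<mid′ : mid Fin.< mid′
  mid<mid′ = ↑ʳ-mono-< (suc K) (s≤s z≤n)

  module _ {Γ} (at : Atom Γ (N * N) 2)
           (closed : Preserves (rel Γ (sym at)) (conM (dom (rel Γ (sym at)))))
           (bound : ∑[ i < ar (rel Γ (sym at)) ] dom (rel Γ (sym at)) ≤ K)
           (mirror : ∀ (u v : Fin N) → Sat₂ at (combine u v) (combine v u)) where

    mid-transposed : Sat₂ at (combine mid mid) (combine mid′ mid)
    mid-transposed =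
      let i , flat₁ = rowConstant-among (map' at) (mono at) below (↑ˡ-mono-< _) bound
          j , flat₂ = rowConstant-among (map' at) (mono at) above
                        (λ i<j → ↑ʳ-mono-< (suc K) (s≤s (s≤s i<j))) bound
      in transpose-closure at closed mirror (↑ˡ-<-↑ʳ i zero) (ℕ.<⇒≤ mid<mid′)
           (↑ʳ-mono-< (suc K) (s≤s (s≤s z≤n))) flat₁ flat₂

languageBound : Language → ℕ
languageBound Γ = ∑[ s < size Γ ] ∑[ i < ar (rel Γ s) ] dom (rel Γ s)

mainTheorem17 : (Γ : Language) →
    (∀ (n : ℕ) → 1 ≤ n → (σ : Permutation′ n) → MoFgppDefinable Γ (graph σ)) →
    ¬ ConnectorProperty Γ
mainTheorem17 Γ definable connector =
  Fin.<⇒≢ mid<mid′ (Fin.combine-injectiveˡ mid mid mid′ mid (begin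
    combine mid mid                      ≡⟨ transposeIndex-combine mid mid ⟨
    gridTranspose N ⟨$⟩ʳ combine mid mid ≡⟨ transposes-mid ⟩
    combine mid′ mid                     ∎))
  where
  open Grid (languageBound Γ)
  open ≡.≡-Reasoning
  definition : MoFgppDefinable Γ (graph (gridTranspose N))
  definition = definable (N * N) (s≤s z≤n) (gridTranspose N)
  φ : List (Atom Γ (N * N) 2)
  φ = proj₁ definition
  defines : ∀ x → (gridTranspose N ⟨$⟩ʳ x zero ≡ x (suc zero)) ⇔ All (λ at → satAtom x at) φ
  defines = proj₂ definition
  mirror : ∀ {at} → at ∈ φ → ∀ u v → Sat₂ at (combine u v) (combine v u)
  mirror at∈φ u v = All.lookup (Equivalence.to (defines (pair _ _)) (transposeIndex-combine u v)) at∈φ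
  transposes-mid : gridTranspose N ⟨$⟩ʳ combine mid mid ≡ combine mid′ mid
  transposes-mid = Equivalence.from (defines (pair _ _)) (All.tabulate λ {at} at∈φ →
    mid-transposed at (connector (sym at)) (≤-sum _ (sym at)) (mirror at∈φ))
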